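{- Let $\mathcal R\subset\mathbb{Z}^k$ be a polyhedral region and let $\mathbf z_1,\mathbf z_2\in\mathcal R$. If each of $\mathbf z_1,\mathbf z_2$ is contained in some $k$-dimensional box of size $1$ contained entirely in $\mathcal R$, then there is a lattice path from $\mathbf z_1$ to $\mathbf z_2$ contained entirely in $\mathcal R$, i.e. a finite sequence $T_1,\ldots,T_N$ of points of $\mathcal R$ with $T_1=\mathbf z_1$, $T_N=\mathbf z_2$, and $T_i-T_{i-1}\in\{\pm\mathbf e_1,\ldots,\pm\mathbf e_k\}$ for $1<i\le N$.
   Context: $\mathbf e_i$ is the $i$-th unit vector. A half-space in $\mathbb{Z}^k$ is $\{\mathbf z:\mathbf v\cdot\mathbf z>n\}$ with $\mathbf v\in\mathbb{Z}^k$, $n\in\mathbb{Z}$; a region is polyhedral if it equals $\mathbb{Z}^k$ or is the intersection of finitely many half-spaces. A $k$-dimensional box of size $1$ is $\{\mathbf z\in\mathbb{Z}^k: c_i\le z_i\le c_i+1,\ i=1,\ldots,k\}$ with $c_i\in\mathbb{Z}$. -}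

module Defs where

open import Data.Nat using (ℕ; suc)
open import Data.Integer using (ℤ; _+_; _*_; _-_; _<_; _≤_; +_; -_)
open import Data.Fin using (Fin; zero; suc; fromℕ; inject₁; _≟_)
open import Data.Bool using (if_then_else_)
open import Relation.Nullary.Decidable using (⌊_⌋)
open import Data.Vec using (Vec; lookup; zipWith; tabulate; map; foldr; _∷_; [])
open import Data.List using (List; []; _∷_)
open import Data.List.Relation.Unary.All using (All)
open import Data.Product using (Σ; ∃; _×_; _,_)
open import Data.Sum using (_⊎_)
open import Relation.Binary.PropositionalEquality using (_≡_)
open import Level using (0ℓ)

Point : ℕ → Set
Point k = Vec ℤ k

_·_ : ∀ {k} → Point k → Point k → ℤ
u · v = foldr _ _+_ (+ 0) (zipWith _*_ u v)

HalfSpaceData : ℕ → Set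
HalfSpaceData k = Point k × ℤ

InHalfSpace : ∀ {k} → HalfSpaceData k → Point k → Set
InHalfSpace (v , n) z = n < v · z

Region : ℕ → Set₁
Region k = Point k → Set

Polyhedral : ∀ {k} → Region k → Set
Polyhedral {k} R =
  (∀ z → R z)
  ⊎ Σ (List (HalfSpaceData k)) (λ hs →
      ∀ z → (R z → All (λ h → InHalfSpace h z) hs)
          × (All (λ h → InHalfSpace h z) hs → R z))

InBox : ∀ {k} → Point k → Point k → Set
InBox c z = ∀ i → (lookup c i ≤ lookup z i) × (lookup z i ≤ lookup c i + + 1)

BoxInside : ∀ {k} → Region k → Point k → Set
BoxInside R c = ∀ z → InBox c z → R z

InUnitBoxOf : ∀ {k} → Region k → Point k → Set
InUnitBoxOf R z = ∃ λ c → InBox c z × BoxInside R c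

unitVec : ∀ {k} → Fin k → Point k
unitVec i = tabulate (λ j → if ⌊ j ≟ i ⌋ then + 1 else + 0)

UnitStep : ∀ {k} → Point k → Point k → Set
UnitStep {k} u w = ∃ λ (i : Fin k) →
  (zipWith _-_ w u ≡ unitVec i) ⊎ (zipWith _-_ w u ≡ map -_ (unitVec i))

-- a lattice path T_1, ..., T_N (N = suc n ≥ 1) from z₁ to z₂ inside R
record LatticePath {k : ℕ} (R : Region k) (z₁ z₂ : Point k) : Set where
  field
    n     : ℕ
    T     : Fin (suc n) → Point k
    inR   : ∀ i → R (T i)
    first : T zero ≡ z₁
    last  : T (fromℕ n) ≡ z₂
    steps : ∀ (i : Fin n) → UnitStep (T (inject₁ i)) (T (suc i))

-- Let the unit boxes with lower corners a and b lie in R, put d = b - a and let D be the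
-- product of the numbers max(1, ∣dᵢ∣). For t + s = D consider the unit box whose lower corner
-- is the rational point (t a + s b) / D. Every half-space containing the boxes at a and b
-- contains it (compare the vertices minimising the normal), so its lattice points lie in R;
-- they form a product of integer intervals, so any two of them are joined by an axis-parallel
-- walk. Since ∣dᵢ∣ divides D, the lower corners of consecutive boxes lie on the grid
-- (∣dᵢ∣ / D) ℤ and differ by one grid step in coordinate i, hence the boxes share a lattice
-- point. Chaining the boxes from s = 0 to s = D joins z₁ to z₂.

module Submission where

open import Defs
open import Data.Nat as ℕ using (ℕ; zero; suc; z≤n; NonZero)
import Data.Nat.Properties as ℕ
import Data.Nat.Divisibility as ℕ
open import Data.Integer as ℤ using (ℤ; _+_; _*_; _-_; -_; _≤_; _<_; +_; -[1+_]; +≤+; +<+; ∣_∣)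
open import Data.Integer.Base using (_/ℕ_) renaming (suc to sucℤ)
import Data.Integer.Properties as ℤ
open import Data.Integer.DivMod using (n<s[n/ℕd]*d; [n/ℕd]*d≤n)
open import Data.Integer.Divisibility.Signed using (_∣_; ∣ᵤ⇒∣; ∣m∣n⇒∣m-n; ∣m∣n⇒∣m+n; ∣m⇒∣m*n; ∣n⇒∣m*n; ∣⇒∣ᵤ)
open import Data.Integer.Tactic.RingSolver using (solve-∀)
open import Data.Fin using (Fin; zero; suc; inject₁; _≟_)
open import Data.Vec using ([]; _∷_; lookup; zipWith; tabulate; map)
open import Data.Vec.Properties using (tabulate-cong; map-∘; map-cong; map-id; lookup-zipWith; lookup∘tabulate)
open import Data.Bool using (if_then_else_)
open import Relation.Nullary.Decidable using (⌊_⌋; yes; no)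
open import Data.Product using (∃; _×_; _,_; proj₁; proj₂; map₂; swap)
open import Data.Sum using (inj₁; inj₂)
import Data.List.Relation.Unary.All as All
open import Data.List.Membership.Propositional using (_∈_)
open import Function using (_∘_)
open import Relation.Binary.PropositionalEquality

data Walk {k : ℕ} (S : Point k → Set) : Point k → Point k → Set where
  stay : ∀ {x} → S x → Walk S x x
  step : ∀ {x y z} → S x → UnitStep x y → Walk S y z → Walk S x z

module _ {k : ℕ} {S : Point k → Set} where

  _++ʷ_ : ∀ {x y z} → Walk S x y → Walk S y z → Walk S x z
  stay _     ++ʷ w′ = w′
  step s u w ++ʷ w′ = step s u (w ++ʷ w′)

  sourceʷ : ∀ {x y} → Walk S x y → S x
  sourceʷ (stay s)     = s
  sourceʷ (step s _ _) = s

  mapʷ : ∀ {S′ : Point k → Set} → (∀ {p} → S p → S′ p) → ∀ {x y} → Walk S x y → Walk S′ x y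
  mapʷ f (stay s)     = stay (f s)
  mapʷ f (step s u w) = step (f s) u (mapʷ f w)

toLatticePath : ∀ {k} {R : Region k} {x y} → Walk R x y → LatticePath R x y
toLatticePath {x = x} (stay s) = record
  { n = 0 ; T = λ _ → x ; inR = λ _ → s ; first = refl ; last = refl ; steps = λ () }
toLatticePath {R = R} {x = x} (step s u w) = record
  { n = suc n ; T = T′ ; inR = inR′ ; first = refl ; last = last ; steps = steps′ }
  where
    open LatticePath (toLatticePath w)
    T′ : Fin (suc (suc n)) → Point _
    T′ zero    = x
    T′ (suc i) = T i
    inR′ : ∀ i → R (T′ i)
    inR′ zero    = s
    inR′ (suc i) = inR i
    steps′ : ∀ (i : Fin (suc n)) → UnitStep (T′ (inject₁ i)) (T′ (suc i))
    steps′ zero    = subst (UnitStep x) (sym first) u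
    steps′ (suc i) = steps i

unitVec-suc : ∀ {k} (i : Fin k) → unitVec (suc i) ≡ + 0 ∷ unitVec i
unitVec-suc i = cong (+ 0 ∷_) (tabulate-cong λ j → cong (λ b → if b then + 1 else + 0) (suc≟suc j))
  where
    suc≟suc : ∀ j → ⌊ suc j ≟ suc i ⌋ ≡ ⌊ j ≟ i ⌋
    suc≟suc j with j ≟ i
    ... | yes _ = refl
    ... | no _  = refl

zipWith-−-self : ∀ {k} (u : Point k) → zipWith _-_ u u ≡ tabulate (λ _ → + 0)
zipWith-−-self []      = refl
zipWith-−-self (x ∷ u) = cong₂ _∷_ (ℤ.+-inverseʳ x) (zipWith-−-self u)

zipWith-−-swap : ∀ {k} (u w : Point k) → zipWith _-_ u w ≡ map (-_) (zipWith _-_ w u)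
zipWith-−-swap []       []       = refl
zipWith-−-swap (x ∷ u) (y ∷ w) = cong₂ _∷_ (x-y≡-[y-x] x y) (zipWith-−-swap u w)
  where
    x-y≡-[y-x] : ∀ x y → x - y ≡ - (y - x)
    x-y≡-[y-x] = solve-∀

map-neg-involutive : ∀ {k} (v : Point k) → map (-_) (map (-_) v) ≡ v
map-neg-involutive v = trans (sym (map-∘ (-_) (-_) v)) (trans (map-cong ℤ.neg-involutive v) (map-id v))

UnitStep-sym : ∀ {k} {u w : Point k} → UnitStep u w → UnitStep w u
UnitStep-sym {u = u} {w} (i , inj₁ w-u≡eᵢ) = i , inj₂ (trans (zipWith-−-swap u w) (cong (map (-_)) w-u≡eᵢ))
UnitStep-sym {u = u} {w} (i , inj₂ w-u≡-eᵢ) = i , inj₁ (begin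
  zipWith _-_ u w                 ≡⟨ zipWith-−-swap u w ⟩
  map (-_) (zipWith _-_ w u)      ≡⟨ cong (map (-_)) w-u≡-eᵢ ⟩
  map (-_) (map (-_) (unitVec i)) ≡⟨ map-neg-involutive (unitVec i) ⟩
  unitVec i                       ∎)
  where open ≡-Reasoning

UnitStep-∷ : ∀ {k} x {u w : Point k} → UnitStep u w → UnitStep (x ∷ u) (x ∷ w)
UnitStep-∷ x (i , inj₁ eq) = suc i , inj₁ (trans (cong₂ _∷_ (ℤ.+-inverseʳ x) eq) (sym (unitVec-suc i)))
UnitStep-∷ x (i , inj₂ eq) =
  suc i , inj₂ (trans (cong₂ _∷_ (ℤ.+-inverseʳ x) eq) (sym (cong (map (-_)) (unitVec-suc i))))

UnitStep-sucℤ : ∀ {k} x (u : Point k) → UnitStep (x ∷ u) (sucℤ x ∷ u)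
UnitStep-sucℤ x u = zero , inj₁ (cong₂ _∷_ (sucℤx-x x) (zipWith-−-self u))
  where
    sucℤx-x : ∀ x → + 1 + x - x ≡ + 1
    sucℤx-x = solve-∀

reverseʷ : ∀ {k} {S : Point k → Set} {x y} → Walk S x y → Walk S y x
reverseʷ (stay s)     = stay s
reverseʷ (step s u w) = reverseʷ w ++ʷ step (sourceʷ w) (UnitStep-sym u) (stay s)

walk-∷ : ∀ {k} {S : Point k → Set} {S′ : Point (suc k) → Set} x →
  (∀ {u} → S u → S′ (x ∷ u)) → ∀ {u w} → Walk S u w → Walk S′ (x ∷ u) (x ∷ w)
walk-∷ x f (stay s)     = stay (f s)
walk-∷ x f (step s u w) = step (f s) (UnitStep-∷ x u) (walk-∷ x f w)

module _ {k : ℕ} {S : Point (suc k) → Set} (u : Point k) where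

  walk-upward-by : ∀ {x} n → (∀ m → m ℕ.≤ n → S ((+ m + x) ∷ u)) → Walk S (x ∷ u) ((+ n + x) ∷ u)
  walk-upward-by {x} zero h =
    subst (λ z → Walk S (z ∷ u) ((+ 0 + x) ∷ u)) (ℤ.+-identityˡ x) (stay (h 0 z≤n))
  walk-upward-by {x} (suc n) h =
    subst (λ z → Walk S (x ∷ u) (z ∷ u)) (sym (ℤ.suc-+ n x))
      (walk-upward-by n (λ m m≤n → h m (ℕ.m≤n⇒m≤1+n m≤n))
        ++ʷ step (h n (ℕ.n≤1+n n)) (UnitStep-sucℤ (+ n + x) u)
                 (stay (subst (λ z → S (z ∷ u)) (ℤ.suc-+ n x) (h (suc n) ℕ.≤-refl))))

  walk-upward : ∀ {x y} → x ≤ y → (∀ z → x ≤ z → z ≤ y → S (z ∷ u)) → Walk S (x ∷ u) (y ∷ u)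
  walk-upward {x} {y} x≤y h =
    subst (λ z → Walk S (x ∷ u) (z ∷ u)) n+x≡y
      (walk-upward-by n λ m m≤n →
        h _ (ℤ.i≤j⇒i≤k+j (+ m) ℤ.≤-refl) (subst (+ m + x ≤_) n+x≡y (ℤ.+-monoˡ-≤ x (+≤+ m≤n))))
    where
      n = ∣ y - x ∣
      [y-x]+x≡y : ∀ x y → y - x + x ≡ y
      [y-x]+x≡y = solve-∀
      n+x≡y : + n + x ≡ y
      n+x≡y = trans (cong (_+ x) (ℤ.0≤i⇒+∣i∣≡i (ℤ.i≤j⇒0≤j-i x≤y))) ([y-x]+x≡y x y)

OrdConvex : (ℤ → Set) → Set
OrdConvex Q = ∀ {x y z} → Q x → Q y → x ≤ z → z ≤ y → Q z

_∈Π_ : ∀ {k} → Point k → (Fin k → ℤ → Set) → Set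
p ∈Π Q = ∀ i → Q i (lookup p i)

walk-∈Π : ∀ {k} (Q : Fin k → ℤ → Set) → (∀ i → OrdConvex (Q i)) →
  ∀ p p′ → p ∈Π Q → p′ ∈Π Q → Walk (_∈Π Q) p p′
walk-∈Π Q convex []      []      p∈ _   = stay p∈
walk-∈Π Q convex (x ∷ u) (y ∷ w) p∈ p′∈ =
  headWalk ++ʷ walk-∷ y (∷-∈Π (p′∈ zero)) (walk-∈Π (Q ∘ suc) (convex ∘ suc) u w (p∈ ∘ suc) (p′∈ ∘ suc))
  where
    ∷-∈Π : ∀ {z v} → Q zero z → v ∈Π (Q ∘ suc) → (z ∷ v) ∈Π Q
    ∷-∈Π qz v∈ zero    = qz
    ∷-∈Π qz v∈ (suc i) = v∈ i
    headWalk : Walk (_∈Π Q) (x ∷ u) (y ∷ u)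
    headWalk with ℤ.≤-total x y
    ... | inj₁ x≤y = walk-upward u x≤y λ z x≤z z≤y →
            ∷-∈Π (convex zero (p∈ zero) (p′∈ zero) x≤z z≤y) (p∈ ∘ suc)
    ... | inj₂ y≤x = reverseʷ (walk-upward u y≤x λ z y≤z z≤x →
            ∷-∈Π (convex zero (p′∈ zero) (p∈ zero) y≤z z≤x) (p∈ ∘ suc))

-- x lies in the real interval [u / N , u / N + 1].
ScaledIn : ℕ → ℤ → ℤ → Set
ScaledIn N u x = u ≤ x * + N × x * + N ≤ u + + N

ScaledBox : ∀ {k} → ℕ → (Fin k → ℤ) → Fin k → ℤ → Set
ScaledBox N q i = ScaledIn N (q i)

ScaledIn-convex : ∀ N u → OrdConvex (ScaledIn N u)
ScaledIn-convex N u (u≤xN , _) (_ , yN≤u+N) x≤z z≤y =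
  ℤ.≤-trans u≤xN (ℤ.*-monoʳ-≤-nonNeg (+ N) x≤z) , ℤ.≤-trans (ℤ.*-monoʳ-≤-nonNeg (+ N) z≤y) yN≤u+N

unitInterval⇒ScaledIn : ∀ N {c x} → c ≤ x → x ≤ c + + 1 → ScaledIn N (c * + N) x
unitInterval⇒ScaledIn N {c} c≤x x≤c+1 =
  ℤ.*-monoʳ-≤-nonNeg (+ N) c≤x ,
  subst (_ ≤_) ([c+1]N≡cN+N c (+ N)) (ℤ.*-monoʳ-≤-nonNeg (+ N) x≤c+1)
  where
    [c+1]N≡cN+N : ∀ c N → (c + + 1) * N ≡ c * N + N
    [c+1]N≡cN+N = solve-∀

mix : ∀ {k} → ℕ → ℕ → Point k → Point k → Fin k → ℤ
mix t s a b i = + t * lookup a i + + s * lookup b i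

negIndicator : ℤ → ℤ
negIndicator (+ _)    = + 0
negIndicator -[1+ _ ] = + 1

minCorner : ∀ {k} → Point k → Point k → Point k
minCorner c v = zipWith (λ cᵢ vᵢ → cᵢ + negIndicator vᵢ) c v

minCorner-inBox : ∀ {k} (c v : Point k) → InBox c (minCorner c v)
minCorner-inBox c v i rewrite lookup-zipWith (λ cᵢ vᵢ → cᵢ + negIndicator vᵢ) i c v with lookup v i
... | + _      = ℤ.≤-reflexive (sym (ℤ.+-identityʳ _)) , ℤ.+-monoʳ-≤ (lookup c i) (+≤+ z≤n)
... | -[1+ _ ] = ℤ.i≤i+j (lookup c i) (+ 1) , ℤ.≤-refl

ScaledIn-dot : ∀ t s v a b x → ScaledIn (t ℕ.+ s) (+ t * a + + s * b) x →
  + t * (v * (a + negIndicator v)) + + s * (v * (b + negIndicator v)) ≤ v * x * + (t ℕ.+ s)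
ScaledIn-dot t s v@(+ _) a b x (lower , _) =
  subst₂ _≤_ (by-lower v a b (+ t) (+ s)) (sym (ℤ.*-assoc v x (+ (t ℕ.+ s)))) (ℤ.*-monoˡ-≤-nonNeg v lower)
  where
    by-lower : ∀ v a b t s → v * (t * a + s * b) ≡ t * (v * (a + + 0)) + s * (v * (b + + 0))
    by-lower = solve-∀
ScaledIn-dot t s v@(-[1+ _ ]) a b x (_ , upper) =
  subst₂ _≤_ (by-upper v a b (+ t) (+ s)) (sym (ℤ.*-assoc v x (+ (t ℕ.+ s)))) (ℤ.*-monoˡ-≤-nonPos v upper)
  where
    by-upper : ∀ v a b t s → v * (t * a + s * b + (t + s)) ≡ t * (v * (a + + 1)) + s * (v * (b + + 1))
    by-upper = solve-∀

ScaledBox-dot : ∀ {k} t s (v a b p : Point k) → p ∈Π ScaledBox (t ℕ.+ s) (mix t s a b) →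
  + t * (v · minCorner a v) + + s * (v · minCorner b v) ≤ (v · p) * + (t ℕ.+ s)
ScaledBox-dot t s [] [] [] [] _ = ℤ.≤-reflexive (empty (+ t) (+ s) (+ (t ℕ.+ s)))
  where
    empty : ∀ t s N → t * + 0 + s * + 0 ≡ + 0 * N
    empty = solve-∀
ScaledBox-dot t s (vᵢ ∷ v) (aᵢ ∷ a) (bᵢ ∷ b) (pᵢ ∷ p) p∈ =
  subst₂ _≤_ (regroup (+ t) (+ s) _ _ _ _) (distrib (+ (t ℕ.+ s)) (vᵢ * pᵢ) (v · p))
    (ℤ.+-mono-≤ (ScaledIn-dot t s vᵢ aᵢ bᵢ pᵢ (p∈ zero)) (ScaledBox-dot t s v a b p (p∈ ∘ suc)))
  where
    regroup : ∀ t s x y x′ y′ → (t * x + s * y) + (t * x′ + s * y′) ≡ t * (x + x′) + s * (y + y′)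
    regroup = solve-∀
    distrib : ∀ N x y → x * N + y * N ≡ (x + y) * N
    distrib = solve-∀

HalfSpace-ScaledBox : ∀ {k N} .{{_ : NonZero N}} t s → t ℕ.+ s ≡ N →
  (h : HalfSpaceData k) (a b : Point k) {p : Point k} →
  (∀ z → InBox a z → InHalfSpace h z) → (∀ z → InBox b z → InHalfSpace h z) →
  p ∈Π ScaledBox N (mix t s a b) → InHalfSpace h p
HalfSpace-ScaledBox {N = N} t s refl (v , n) a b {p} a⊆h b⊆h p∈ =
  ℤ.suc[i]≤j⇒i<j (ℤ.*-cancelʳ-≤-pos (sucℤ n) (v · p) (+ N) {{N>0}} (begin
    sucℤ n * + N                                            ≡⟨ split (sucℤ n) (+ t) (+ s) ⟩
    + t * sucℤ n + + s * sucℤ n                             ≤⟨ ℤ.+-mono-≤ (bound t a a⊆h) (bound s b b⊆h) ⟩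
    + t * (v · minCorner a v) + + s * (v · minCorner b v)   ≤⟨ ScaledBox-dot t s v a b p p∈ ⟩
    (v · p) * + N                                           ∎))
  where
    open ℤ.≤-Reasoning
    N>0 = ℤ.positive (+<+ (ℕ.>-nonZero⁻¹ N))
    split : ∀ x t s → x * (t + s) ≡ t * x + s * x
    split = solve-∀
    bound : ∀ r c → (∀ z → InBox c z → InHalfSpace (v , n) z) → + r * sucℤ n ≤ + r * (v · minCorner c v)
    bound r c c⊆h = ℤ.*-monoˡ-≤-nonNeg (+ r) (ℤ.i<j⇒suc[i]≤j (c⊆h _ (minCorner-inBox c v)))

Polyhedral-ScaledBox : ∀ {k N} .{{_ : NonZero N}} {R : Region k} → Polyhedral R →
  ∀ a b → BoxInside R a → BoxInside R b →
  ∀ t s → t ℕ.+ s ≡ N → ∀ {p} → p ∈Π ScaledBox N (mix t s a b) → R p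
Polyhedral-ScaledBox (inj₁ R-full) _ _ _ _ _ _ _ {p} _ = R-full p
Polyhedral-ScaledBox {R = R} (inj₂ (hs , R⇔hs)) a b boxA boxB t s t+s≡N {p} p∈ =
  proj₂ (R⇔hs p) (All.tabulate λ {h} h∈hs →
    HalfSpace-ScaledBox t s t+s≡N h a b (inside a h∈hs boxA) (inside b h∈hs boxB) p∈)
  where
    inside : ∀ {h} c → h ∈ hs → BoxInside R c → ∀ z → InBox c z → InHalfSpace h z
    inside c h∈hs box z z∈ = All.lookup (proj₁ (R⇔hs z) (box z z∈)) h∈hs

positive-multiple-≥ : ∀ g {x} → + 0 < x → + g ∣ x → + g ≤ x
positive-multiple-≥ g {+ zero}  (+<+ ())
positive-multiple-≥ g {+ suc m} _ g∣x = +≤+ (ℕ.∣⇒≤ (∣⇒∣ᵤ g∣x))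

multiples-gap : ∀ g {u v} → + g ∣ u → + g ∣ v → u < v → u + + g ≤ v
multiples-gap g {u} {v} g∣u g∣v u<v = begin
  u + + g       ≤⟨ ℤ.+-monoʳ-≤ u (positive-multiple-≥ g 0<v-u (∣m∣n⇒∣m-n g∣v g∣u)) ⟩
  u + (v - u)   ≡⟨ u+[v-u]≡v u v ⟩
  v             ∎
  where
    open ℤ.≤-Reasoning
    u+[v-u]≡v : ∀ u v → u + (v - u) ≡ v
    u+[v-u]≡v = solve-∀
    0<v-u : + 0 < v - u
    0<v-u = subst (_< v - u) (ℤ.+-inverseʳ u) (ℤ.+-monoˡ-< (- u) u<v)

next-multiple : ∀ N .{{_ : NonZero N}} u → ∃ λ x → u < x * + N × x * + N ≤ u + + N
next-multiple N u = sucℤ q , n<s[n/ℕd]*d u N , (begin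
  sucℤ q * + N    ≡⟨ ℤ.suc-* q (+ N) ⟩
  + N + q * + N   ≤⟨ ℤ.+-monoʳ-≤ (+ N) ([n/ℕd]*d≤n u N) ⟩
  + N + u         ≡⟨ ℤ.+-comm (+ N) u ⟩
  u + + N         ∎)
  where
    open ℤ.≤-Reasoning
    q = u /ℕ N

-- The least multiple x N of N above u is a multiple of g as u is, so it exceeds u by at least g.
ScaledIn-overlap-≤ : ∀ N .{{_ : NonZero N}} g {u u′} → + g ∣ + N → + g ∣ u →
  u ≤ u′ → u′ ≤ u + + g → ∃ λ x → ScaledIn N u x × ScaledIn N u′ x
ScaledIn-overlap-≤ N g {u} {u′} g∣N g∣u u≤u′ u′≤u+g with next-multiple N u
... | x , u<xN , xN≤u+N =
  x , (ℤ.<⇒≤ u<xN , xN≤u+N) ,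
      (ℤ.≤-trans u′≤u+g (multiples-gap g g∣u (∣n⇒∣m*n x g∣N) u<xN) ,
       ℤ.≤-trans xN≤u+N (ℤ.+-monoˡ-≤ (+ N) u≤u′))

ScaledIn-overlap : ∀ N .{{_ : NonZero N}} g {u} e → + g ∣ + N → + g ∣ u → + g ∣ e → ∣ e ∣ ℕ.≤ g →
  ∃ λ x → ScaledIn N u x × ScaledIn N (u + e) x
ScaledIn-overlap N g {u} (+ n) g∣N g∣u _ n≤g =
  ScaledIn-overlap-≤ N g g∣N g∣u (ℤ.i≤i+j u (+ n)) (ℤ.+-monoʳ-≤ u (+≤+ n≤g))
ScaledIn-overlap N g {u} e@(-[1+ n ]) g∣N g∣u g∣e n<g =
  map₂ swap (ScaledIn-overlap-≤ N g g∣N (∣m∣n⇒∣m+n g∣u g∣e) (ℤ.i-j≤i u (+ suc n)) (begin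
    u                       ≡⟨ ℤ.+-identityʳ u ⟨
    u + + 0                 ≤⟨ ℤ.+-monoʳ-≤ u (ℤ.i≤j⇒0≤j-i (+≤+ n<g)) ⟩
    u + (+ g - + suc n)     ≡⟨ u+[g-m]≡u-m+g u (+ g) (+ suc n) ⟩
    u + e + + g             ∎))
  where
    open ℤ.≤-Reasoning
    u+[g-m]≡u-m+g : ∀ u g m → u + (g - m) ≡ u - m + g
    u+[g-m]≡u-m+g = solve-∀

stride : ℤ → ℕ
stride (+ zero)  = 1
stride (+ suc m) = suc m
stride -[1+ m ]  = suc m

stride-∣ : ∀ e → + stride e ∣ e
stride-∣ (+ zero)  = ∣ᵤ⇒∣ (ℕ.1∣ 0)
stride-∣ (+ suc m) = ∣ᵤ⇒∣ ℕ.∣-refl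
stride-∣ -[1+ m ]  = ∣ᵤ⇒∣ ℕ.∣-refl

∣∣≤stride : ∀ e → ∣ e ∣ ℕ.≤ stride e
∣∣≤stride (+ zero)  = z≤n
∣∣≤stride (+ suc m) = ℕ.≤-refl
∣∣≤stride -[1+ m ]  = ℕ.≤-refl

stride-nonZero : ∀ e → NonZero (stride e)
stride-nonZero (+ zero)  = _
stride-nonZero (+ suc m) = _
stride-nonZero -[1+ m ]  = _

period : ∀ {k} → Point k → ℕ
period []      = 1
period (e ∷ d) = stride e ℕ.* period d

period-nonZero : ∀ {k} (d : Point k) → NonZero (period d)
period-nonZero []      = _
period-nonZero (e ∷ d) = ℕ.m*n≢0 (stride e) (period d) {{stride-nonZero e}} {{period-nonZero d}}

stride∣period : ∀ {k} (d : Point k) i → stride (lookup d i) ℕ.∣ period d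
stride∣period (e ∷ d) zero    = ℕ.m∣m*n (period d)
stride∣period (e ∷ d) (suc i) = ℕ.∣n⇒∣m*n (stride e) (stride∣period d i)

∃-∈Π : ∀ {k} {Q : Fin k → ℤ → Set} → (∀ i → ∃ (Q i)) → ∃ (_∈Π Q)
∃-∈Π {Q = Q} choose =
  tabulate (proj₁ ∘ choose) ,
  λ i → subst (Q i) (sym (lookup∘tabulate (proj₁ ∘ choose) i)) (proj₂ (choose i))

module Segment {k : ℕ} {R : Region k} (polyhedral : Polyhedral R)
               (a b : Point k) (boxA : BoxInside R a) (boxB : BoxInside R b) where

  d : Point k
  d = zipWith _-_ b a

  D : ℕ
  D = period d

  instance
    D-nonZero : NonZero D
    D-nonZero = period-nonZero d

  stride∣D : ∀ i → + stride (lookup d i) ∣ + D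
  stride∣D i = ∣ᵤ⇒∣ (stride∣period d i)

  Slice : ℕ → ℕ → Point k → Set
  Slice t s p = p ∈Π ScaledBox D (mix t s a b)

  walk-in-slice : ∀ t s → t ℕ.+ s ≡ D → ∀ p p′ → Slice t s p → Slice t s p′ → Walk R p p′
  walk-in-slice t s t+s≡D p p′ p∈ p′∈ =
    mapʷ (Polyhedral-ScaledBox polyhedral a b boxA boxB t s t+s≡D)
         (walk-∈Π _ (λ i → ScaledIn-convex D (mix t s a b i)) p p′ p∈ p′∈)

  corner-divisible : ∀ t s → t ℕ.+ s ≡ D → ∀ i → + stride (lookup d i) ∣ mix t s a b i
  corner-divisible t s t+s≡D i =
    subst (_ ∣_) (sym corner≡Da+sd)
      (∣m∣n⇒∣m+n (∣m⇒∣m*n (lookup a i) (stride∣D i)) (∣n⇒∣m*n (+ s) (stride-∣ (lookup d i))))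
    where
      ta+sb≡[t+s]a+s[b-a] : ∀ t s a b → t * a + s * b ≡ (t + s) * a + s * (b - a)
      ta+sb≡[t+s]a+s[b-a] = solve-∀
      corner≡Da+sd : mix t s a b i ≡ + D * lookup a i + + s * lookup d i
      corner≡Da+sd = trans (ta+sb≡[t+s]a+s[b-a] (+ t) (+ s) (lookup a i) (lookup b i))
        (cong₂ (λ N e → + N * lookup a i + + s * e) t+s≡D (sym (lookup-zipWith _-_ i b a)))

  corner-step : ∀ t s i → mix t (suc s) a b i ≡ mix (suc t) s a b i + lookup d i
  corner-step t s i = trans (step-identity (+ t) (+ s) (lookup a i) (lookup b i))
                            (cong (λ e → mix (suc t) s a b i + e) (sym (lookup-zipWith _-_ i b a)))
    where
      step-identity : ∀ t s a b → t * a + (+ 1 + s) * b ≡ (+ 1 + t) * a + s * b + (b - a)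
      step-identity = solve-∀

  slices-overlap : ∀ t s → suc t ℕ.+ s ≡ D → ∃ λ p → Slice (suc t) s p × Slice t (suc s) p
  slices-overlap t s eq =
    let p , p∈ = ∃-∈Π λ i → ScaledIn-overlap D (stride (lookup d i)) (lookup d i)
                   (stride∣D i) (corner-divisible (suc t) s eq i)
                   (stride-∣ (lookup d i)) (∣∣≤stride (lookup d i))
    in p , proj₁ ∘ p∈ ,
       λ i → subst (λ u → ScaledIn D u (lookup p i)) (sym (corner-step t s i)) (proj₂ (p∈ i))

  walk-to-last-slice : ∀ t s → t ℕ.+ s ≡ D → ∀ p p′ → Slice t s p → Slice 0 D p′ → Walk R p p′
  walk-to-last-slice zero    s s≡D p p′ p∈ p′∈ =
    walk-in-slice 0 s s≡D p p′ p∈ (subst (λ s → Slice 0 s p′) (sym s≡D) p′∈)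
  walk-to-last-slice (suc t) s eq  p p′ p∈ p′∈ =
    let r , r∈ , r∈′ = slices-overlap t s eq
    in walk-in-slice (suc t) s eq p r p∈ r∈
       ++ʷ walk-to-last-slice t (suc s) (trans (ℕ.+-suc t s) eq) r p′ r∈′ p′∈

  InBox⇒first-slice : ∀ z → InBox a z → Slice D 0 z
  InBox⇒first-slice z z∈ i =
    subst (λ u → ScaledIn D u (lookup z i)) (aN≡Na+0b (lookup a i) (lookup b i) (+ D))
      (unitInterval⇒ScaledIn D (proj₁ (z∈ i)) (proj₂ (z∈ i)))
    where
      aN≡Na+0b : ∀ a b N → a * N ≡ N * a + + 0 * b
      aN≡Na+0b = solve-∀

  InBox⇒last-slice : ∀ z → InBox b z → Slice 0 D z
  InBox⇒last-slice z z∈ i =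
    subst (λ u → ScaledIn D u (lookup z i)) (bN≡0a+Nb (lookup a i) (lookup b i) (+ D))
      (unitInterval⇒ScaledIn D (proj₁ (z∈ i)) (proj₂ (z∈ i)))
    where
      bN≡0a+Nb : ∀ a b N → b * N ≡ + 0 * a + N * b
      bN≡0a+Nb = solve-∀

mainTheorem19 : ∀ (k : ℕ) (R : Region k) → Polyhedral R →
    ∀ (z₁ z₂ : Point k) → R z₁ → R z₂ →
    InUnitBoxOf R z₁ → InUnitBoxOf R z₂ →
    LatticePath R z₁ z₂
mainTheorem19 k R polyhedral z₁ z₂ _ _ (a , z₁∈a , boxA) (b , z₂∈b , boxB) =
  toLatticePath (walk-to-last-slice D 0 (ℕ.+-identityʳ D) z₁ z₂
                   (InBox⇒first-slice z₁ z₁∈a) (InBox⇒last-slice z₂ z₂∈b))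
  where open Segment polyhedral a b boxA boxB
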